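{- $\mu(3,1,3)\leq 22$, $\mu(3,1,4)\leq 19$, and $\mu(3,1,q)\leq 16$ for all $q\geq 5$.
   Context: A literal is a propositional variable $x$ or its negation $\overline{x}$; a clause is a finite set of literals not containing both a literal and its negation; a CNF formula is a finite set of clauses. A $(k,p,q)$-formula is a CNF formula in which every clause contains exactly $k$ distinct literals and every variable occurs positively in at most $p$ clauses and negatively in at most $q$ clauses. $\mu(k,p,q)$ is the number of clauses of a smallest unsatisfiable $(k,p,q)$-formula ($\infty$ if none exists). -}

module Defs where

open import Data.Nat using (ℕ; _≤_)
open import Data.Bool using (Bool; true; false)
open import Data.Product using (Σ; _×_; _,_; proj₁; proj₂)
open import Data.Product.Properties using (≡-dec)
open import Data.List using (List; length; filter)
open import Data.List.Relation.Unary.All using (All)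
open import Data.List.Relation.Unary.Any using (Any)
open import Data.List.Relation.Unary.Unique.Propositional using (Unique)
open import Data.List.Relation.Unary.AllPairs using (AllPairs)
open import Data.List.Relation.Binary.Permutation.Propositional using (_↭_)
import Data.Nat.Properties as ℕP
import Data.Bool.Properties as BP
open import Relation.Binary.PropositionalEquality using (_≡_)
open import Relation.Nullary using (¬_)
open import Data.Empty using (⊥)

-- A literal is a pair (variable, polarity): (x , true) is x, (x , false) is x̄.
Literal : Set
Literal = ℕ × Bool

_≟L_ : (a b : Literal) → Relation.Nullary.Dec (a ≡ b)
_≟L_ = ≡-dec ℕP._≟_ BP._≟_

open import Data.List.Membership.DecPropositional _≟L_ using (_∈_; _∈?_)

-- A clause is represented by a list of literals (read as a set).
Clause : Set
Clause = List Literal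

-- A CNF formula is represented by a list of clauses (read as a set).
Formula : Set
Formula = List Clause

neg : Literal → Literal
neg (x , b) = (x , Data.Bool.not b)

IsClause : Clause → Set
IsClause C = Unique C × All (λ l → ¬ (neg l ∈ C)) C

DistinctClauses : Formula → Set
DistinctClauses F = AllPairs (λ C D → ¬ (C ↭ D)) F

occ : Formula → Literal → ℕ
occ F l = length (filter (λ C → l ∈? C) F)

IsKPQFormula : ℕ → ℕ → ℕ → Formula → Set
IsKPQFormula k p q F =
  DistinctClauses F ×
  All (λ C → IsClause C × length C ≡ k) F ×
  ((x : ℕ) → occ F (x , true) ≤ p × occ F (x , false) ≤ q)

SatLit : (ℕ → Bool) → Literal → Set
SatLit α (x , b) = α x ≡ b

Satisfiable : Formula → Set
Satisfiable F = Σ (ℕ → Bool) λ α → All (λ C → Any (SatLit α) C) F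

Unsatisfiable : Formula → Set
Unsatisfiable F = ¬ Satisfiable F

μ≤ : ℕ → ℕ → ℕ → ℕ → Set
μ≤ k p q m = Σ Formula λ F → IsKPQFormula k p q F × Unsatisfiable F × length F ≤ m

-- Each formula is a positive root clause (s₁ ∨ s₂ ∨ s₃) together with, for every sᵢ, a
-- block of clauses refuted by sᵢ = true.  The block for s starts with (s̄ ∨ d ∨ e) and then
-- refutes s ∧ d and s ∧ e.  A pair u ∧ v is refuted either directly by (ū ∨ v̄ ∨ z), (ū ∨ v̄ ∨ z̄),
-- costing two clauses and two negative occurrences of u, or by (ū ∨ v̄ ∨ x) followed by a direct
-- refutation of v ∧ x, costing three clauses but only one negative occurrence of u.  Refuting
-- both, one or none of the two pairs of a block directly gives 5, 6 or 7 clauses per block and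
-- at most 5, 4 or 3 negative occurrences per variable; every variable occurs positively once.
module Submission where

open import Defs
open import Data.Nat using (ℕ; _≤_; _<_; _<?_; _≤?_; z≤n)
open import Data.Nat.Properties using (≤-refl; ≤-trans; <⇒≱; ≮⇒≥; _≟_)
open import Data.Product using (_×_; _,_; proj₁; proj₂)
open import Data.Bool using (Bool; true; false)
open import Data.List using ([]; _∷_; _++_; length)
open import Data.List.Relation.Unary.All as All using (All; []; _∷_)
open import Data.List.Relation.Unary.All.Properties using (++⁻)
open import Data.List.Relation.Unary.Any as Any using (Any; here; there)
open import Data.List.Relation.Unary.AllPairs as AllPairs using (AllPairs)
open import Data.List.Relation.Binary.Permutation.Propositional using (_↭_)
open import Data.List.Relation.Binary.Permutation.Propositional.Properties using (∈-resp-↭)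
open import Data.List.Relation.Binary.Subset.Propositional using (_⊆_)
open import Data.List.Properties using (filter-none)
open import Data.Fin using (Fin; toℕ; fromℕ<)
open import Data.Fin.Properties using (toℕ-fromℕ<)
import Data.Fin.Properties as Fin
open import Relation.Binary.PropositionalEquality using (_≡_; refl; sym; cong; subst)
open import Relation.Nullary using (¬_; Dec; yes; no; ¬?)
open import Relation.Nullary.Decidable using (from-yes; _×-dec_)
open import Data.Empty using (⊥; ⊥-elim)
open import Function using (_∘_)
open import Data.List.Membership.DecPropositional _≟L_ using (_∈_; _∈?_)

_⁺ _⁻ : ℕ → Literal
x ⁺ = (x , true)
x ⁻ = (x , false)

clause : Literal → Literal → Literal → Clause
clause a b c = a ∷ b ∷ c ∷ []

_⊨_ : (ℕ → Bool) → Formula → Set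
α ⊨ F = All (Any (SatLit α)) F

RefutedBy : ℕ → Formula → Set
RefutedBy s G = ∀ α → α s ≡ true → ¬ (α ⊨ G)

RefutedByBoth : ℕ → ℕ → Formula → Set
RefutedByBoth u v G = ∀ α → α u ≡ true → α v ≡ true → ¬ (α ⊨ G)

true≢false : ∀ {b : Bool} → b ≡ true → ¬ b ≡ false
true≢false refl ()

forbid : ℕ → ℕ → ℕ → Formula
forbid u v z = clause (u ⁻) (v ⁻) (z ⁺) ∷ clause (u ⁻) (v ⁻) (z ⁻) ∷ []

forbid-refutes : ∀ u v z → RefutedByBoth u v (forbid u v z)
forbid-refutes u v z α tu tv (c ∷ c̄ ∷ []) = go c c̄
  where
  go : Any (SatLit α) (clause (u ⁻) (v ⁻) (z ⁺)) → Any (SatLit α) (clause (u ⁻) (v ⁻) (z ⁻)) → ⊥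
  go (here fu) _ = true≢false tu fu
  go (there (here fv)) _ = true≢false tv fv
  go (there (there (here tz))) (here fu) = true≢false tu fu
  go (there (there (here tz))) (there (here fv)) = true≢false tv fv
  go (there (there (here tz))) (there (there (here fz))) = true≢false tz fz

implies : ∀ {α : ℕ → Bool} {u v x} → α u ≡ true → α v ≡ true
        → Any (SatLit α) (clause (u ⁻) (v ⁻) (x ⁺)) → α x ≡ true
implies tu tv (here fu) = ⊥-elim (true≢false tu fu)
implies tu tv (there (here fv)) = ⊥-elim (true≢false tv fv)
implies tu tv (there (there (here tx))) = tx

forbid-via : ℕ → ℕ → ℕ → ℕ → Formula
forbid-via u v x z = clause (u ⁻) (v ⁻) (x ⁺) ∷ forbid v x z

forbid-via-refutes : ∀ u v x z → RefutedByBoth u v (forbid-via u v x z)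
forbid-via-refutes u v x z α tu tv (c ∷ cs) =
  forbid-refutes v x z α tv (implies tu tv c) cs

block : ℕ → ℕ → ℕ → Formula → Formula → Formula
block s d e K L = clause (s ⁻) (d ⁺) (e ⁺) ∷ K ++ L

block-refutes : ∀ {s d e K L} → RefutedByBoth s d K → RefutedByBoth s e L
              → RefutedBy s (block s d e K L)
block-refutes {s} {d} {e} {K} refK refL α ts (c ∷ cs) with ++⁻ K cs
... | sK , sL = case c
  where
  case : Any (SatLit α) (clause (s ⁻) (d ⁺) (e ⁺)) → ⊥
  case (here fs) = true≢false ts fs
  case (there (here td)) = refK α ts td sK
  case (there (there (here te))) = refL α ts te sL

rooted : Formula → Formula → Formula → Formula
rooted A B C = clause (0 ⁺) (1 ⁺) (2 ⁺) ∷ A ++ B ++ C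

rooted-unsat : ∀ {A B C} → RefutedBy 0 A → RefutedBy 1 B → RefutedBy 2 C
             → Unsatisfiable (rooted A B C)
rooted-unsat {A} {B} refA refB refC (α , r ∷ cs) with ++⁻ A cs
... | sA , sBC with ++⁻ B sBC
... | sB , sC = case r
  where
  case : Any (SatLit α) (clause (0 ⁺) (1 ⁺) (2 ⁺)) → ⊥
  case (here t₀) = refA α t₀ sA
  case (there (here t₁)) = refB α t₁ sB
  case (there (there (here t₂))) = refC α t₂ sC

_⊈_ : Clause → Clause → Set
C ⊈ D = Any (λ l → ¬ l ∈ D) C

⊈⇒¬⊆ : ∀ {C D} → C ⊈ D → ¬ (C ⊆ D)
⊈⇒¬⊆ (here l∉D) C⊆D = l∉D (C⊆D (here refl))
⊈⇒¬⊆ (there C⊈D) C⊆D = ⊈⇒¬⊆ C⊈D (C⊆D ∘ there)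

⊈⇒≭ : ∀ {C D} → C ⊈ D → ¬ (C ↭ D)
⊈⇒≭ C⊈D C↭D = ⊈⇒¬⊆ C⊈D (∈-resp-↭ C↭D)

VarsBelow : ℕ → Formula → Set
VarsBelow N = All (All (λ l → proj₁ l < N))

OccBound : ℕ → ℕ → Formula → ℕ → Set
OccBound p q F x = occ F (x ⁺) ≤ p × occ F (x ⁻) ≤ q

occ-≡0 : ∀ {N F} → VarsBelow N F → ∀ {x} b → N ≤ x → occ F (x , b) ≡ 0
occ-≡0 {N} {F} below {x} b N≤x = cong length (filter-none (λ C → (x , b) ∈? C) (All.map ∉ below))
  where
  ∉ : ∀ {C} → All (λ l → proj₁ l < N) C → ¬ ((x , b) ∈ C)
  ∉ (y<N ∷ _) (here refl) = <⇒≱ y<N N≤x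
  ∉ (_ ∷ below) (there x∈C) = ∉ below x∈C

occ-bounded : ∀ {N p q F} → VarsBelow N F → (∀ (i : Fin N) → OccBound p q F (toℕ i))
            → ∀ x → OccBound p q F x
occ-bounded {N} {p} {q} {F} below bounded x with x <? N
... | yes x<N = subst (OccBound p q F) (toℕ-fromℕ< x<N) (bounded (fromℕ< x<N))
... | no x≮N = vanish true , vanish false
  where
  vanish : ∀ {m} b → occ F (x , b) ≤ m
  vanish b = subst (_≤ _) (sym (occ-≡0 below b (≮⇒≥ x≮N))) z≤n

-- N bounds the variables, so that the occurrence bounds are a finite check.
Certificate : ℕ → ℕ → ℕ → ℕ → Formula → Set
Certificate k p q N F =
  AllPairs _⊈_ F ×
  All (λ C → IsClause C × length C ≡ k) F ×
  VarsBelow N F ×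
  (∀ (i : Fin N) → OccBound p q F (toℕ i))

certificate? : ∀ k p q N F → Dec (Certificate k p q N F)
certificate? k p q N F =
  AllPairs.allPairs? (λ C D → Any.any? (λ l → ¬? (l ∈? D)) C) F ×-dec
  All.all? (λ C → isClause? C ×-dec (length C ≟ k)) F ×-dec
  All.all? (All.all? (λ l → proj₁ l <? N)) F ×-dec
  Fin.all? (λ i → (occ F (toℕ i ⁺) ≤? p) ×-dec (occ F (toℕ i ⁻) ≤? q))
  where
  isClause? : ∀ C → Dec (IsClause C)
  isClause? C = AllPairs.allPairs? (λ a b → ¬? (a ≟L b)) C ×-dec All.all? (λ l → ¬? (neg l ∈? C)) C

certificate⇒kpq : ∀ {k p q N F} → Certificate k p q N F → IsKPQFormula k p q F
certificate⇒kpq (distinct , clauses , below , bounded) =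
  AllPairs.map ⊈⇒≭ distinct , clauses , occ-bounded below bounded

kpq-mono-q : ∀ {k p q q′ F} → q ≤ q′ → IsKPQFormula k p q F → IsKPQFormula k p q′ F
kpq-mono-q q≤q′ (distinct , clauses , bounded) =
  distinct , clauses , λ x → proj₁ (bounded x) , ≤-trans (proj₂ (bounded x)) q≤q′

F₃ : Formula
F₃ = rooted (block 0 3 4 (forbid-via 0 3 5 6) (forbid-via 0 4 7 8))
            (block 1 9 10 (forbid-via 1 9 11 12) (forbid-via 1 10 13 14))
            (block 2 15 16 (forbid-via 2 15 17 18) (forbid-via 2 16 19 20))

F₄ : Formula
F₄ = rooted (block 0 3 4 (forbid 0 3 5) (forbid-via 0 4 6 7))
            (block 1 8 9 (forbid 1 8 10) (forbid-via 1 9 11 12))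
            (block 2 13 14 (forbid 2 13 15) (forbid-via 2 14 16 17))

F₅ : Formula
F₅ = rooted (block 0 3 4 (forbid 0 3 5) (forbid 0 4 6))
            (block 1 7 8 (forbid 1 7 9) (forbid 1 8 10))
            (block 2 11 12 (forbid 2 11 13) (forbid 2 12 14))

F₃-unsat : Unsatisfiable F₃
F₃-unsat = rooted-unsat
  (block-refutes (forbid-via-refutes 0 3 5 6) (forbid-via-refutes 0 4 7 8))
  (block-refutes (forbid-via-refutes 1 9 11 12) (forbid-via-refutes 1 10 13 14))
  (block-refutes (forbid-via-refutes 2 15 17 18) (forbid-via-refutes 2 16 19 20))

F₄-unsat : Unsatisfiable F₄
F₄-unsat = rooted-unsat
  (block-refutes (forbid-refutes 0 3 5) (forbid-via-refutes 0 4 6 7))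
  (block-refutes (forbid-refutes 1 8 10) (forbid-via-refutes 1 9 11 12))
  (block-refutes (forbid-refutes 2 13 15) (forbid-via-refutes 2 14 16 17))

F₅-unsat : Unsatisfiable F₅
F₅-unsat = rooted-unsat
  (block-refutes (forbid-refutes 0 3 5) (forbid-refutes 0 4 6))
  (block-refutes (forbid-refutes 1 7 9) (forbid-refutes 1 8 10))
  (block-refutes (forbid-refutes 2 11 13) (forbid-refutes 2 12 14))

F₃-kpq : IsKPQFormula 3 1 3 F₃
F₃-kpq = certificate⇒kpq (from-yes (certificate? 3 1 3 21 F₃))

F₄-kpq : IsKPQFormula 3 1 4 F₄
F₄-kpq = certificate⇒kpq (from-yes (certificate? 3 1 4 18 F₄))

F₅-kpq : IsKPQFormula 3 1 5 F₅
F₅-kpq = certificate⇒kpq (from-yes (certificate? 3 1 5 15 F₅))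

corollary9 : μ≤ 3 1 3 22 × μ≤ 3 1 4 19 × ((q : ℕ) → 5 ≤ q → μ≤ 3 1 q 16)
corollary9 = (F₃ , F₃-kpq , F₃-unsat , ≤-refl)
           , (F₄ , F₄-kpq , F₄-unsat , ≤-refl)
           , λ q 5≤q → F₅ , kpq-mono-q 5≤q F₅-kpq , F₅-unsat , ≤-refl
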